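{- Let $G$ be a 2-connected graph equipped with a normal spanning tree $T$ and a numbering of its vertices compatible with $T$. For every vertex $v\in V(G)$, there is a leftmost descendant of $v$ which is adjacent to $lwpt(v)$.
   Context: $T$ is rooted; $ND(v)$ is the number of descendants; normal: endpoints of every edge of $G$ comparable in $T$. $L(v)$: proper ancestors of $v$ adjacent in $G$ to some descendant of $v$ (including $v$); $lwpt_k(v)$: $k$-th element of $L(v)$ closest to the root if $|L(v)|\ge k$, else $v$; $lwpt=lwpt_1$. Vertices are identified with $[n]$; the numbering is compatible with $T$ if descendants of each $j$ form exactly $[j,j+ND(j)-1]$ and siblings $j<k$ satisfy $(-lwpt_1(j),lwpt_2(j))\le_{lex}(-lwpt_1(k),lwpt_2(k))$. The left child of a non-leaf vertex is its largest child; $w$ is a leftmost descendant of $v$ if there is a sequence $v=v_0,v_1,\dots,v_k=w$ ($k\ge0$) with each $v_i$ the left child of $v_{i-1}$. -}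

module Defs where

open import Data.Nat using (ℕ; zero; suc; _+_; _≤_; _<_; _≡ᵇ_)
open import Data.Fin using (Fin; toℕ; _≟_)
open import Data.Bool using (Bool; true; false; _∧_; not)
open import Data.Bool.ListAction using (any)
open import Data.List using (List; []; _∷_; filterᵇ; allFin; upTo; length)
open import Data.Product using (Σ; ∃; _×_; _,_)
open import Data.Sum using (_⊎_)
open import Relation.Nullary.Decidable using (⌊_⌋)
open import Relation.Binary.PropositionalEquality using (_≡_; _≢_)

-- Vertices are Fin n (the paper's [n], shifted to 0-based numbering).
-- A graph is a boolean adjacency relation E.
Graph : ℕ → Set
Graph n = Fin n → Fin n → Bool

IsSimple : ∀ {n} → Graph n → Set
IsSimple {n} E = (∀ u v → E u v ≡ E v u) × (∀ v → E v v ≡ false)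

data Reach {n} (E : Graph n) (ok : Fin n → Bool) : Fin n → Fin n → Set where
  here : ∀ {u} → ok u ≡ true → Reach E ok u u
  step : ∀ {u w v} → ok u ≡ true → E u w ≡ true → Reach E ok w v → Reach E ok u v

allV : ∀ {n} → Fin n → Bool
allV _ = true

Connected : ∀ {n} → Graph n → Set
Connected {n} E = (u v : Fin n) → Reach E allV u v

minus : ∀ {n} → Fin n → Fin n → Bool
minus x y = not ⌊ y ≟ x ⌋

-- 2-connected (Diestel): more than 2 vertices, and G - X connected for |X| < 2
TwoConnected : ∀ {n} → Graph n → Set
TwoConnected {n} E =
  (3 ≤ n) × Connected E ×
  ((x u v : Fin n) → u ≢ x → v ≢ x → Reach E (minus x) u v)

-- A rooted tree on Fin n is given by a root r and a parent map par (par r = r).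
iter : ∀ {n} → (Fin n → Fin n) → ℕ → Fin n → Fin n
iter par zero w = w
iter par (suc k) w = par (iter par k w)

-- anc par u w ≡ true  iff  u is an ancestor of w (u = w allowed),
-- i.e. w is a descendant of u. (Chains of length < n suffice in a tree.)
anc : ∀ {n} → (Fin n → Fin n) → Fin n → Fin n → Bool
anc {n} par u w = any (λ k → ⌊ iter par k w ≟ u ⌋) (upTo n)

IsSpanningTree : ∀ {n} → Graph n → Fin n → (Fin n → Fin n) → Set
IsSpanningTree {n} E r par =
  (par r ≡ r) × ((v : Fin n) → v ≢ r → E v (par v) ≡ true) ×
  ((v : Fin n) → ∃ λ k → iter par k v ≡ r)

IsNormal : ∀ {n} → Graph n → (Fin n → Fin n) → Set
IsNormal {n} E par =
  (u w : Fin n) → E u w ≡ true → (anc par u w ≡ true) ⊎ (anc par w u ≡ true)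

ND : ∀ {n} → (Fin n → Fin n) → Fin n → ℕ
ND {n} par v = length (filterᵇ (anc par v) (allFin n))

inL : ∀ {n} → Graph n → (Fin n → Fin n) → Fin n → Fin n → Bool
inL {n} E par v u =
  anc par u v ∧ not ⌊ u ≟ v ⌋ ∧ any (λ w → anc par v w ∧ E u w) (allFin n)

-- number of elements of L(v) lying on the root path of u (u included);
-- u ∈ L(v) is the k-th element of L(v) closest to the root iff this is k
rankL : ∀ {n} → Graph n → (Fin n → Fin n) → Fin n → Fin n → ℕ
rankL {n} E par v u = length (filterᵇ (λ u' → inL E par v u' ∧ anc par u' u) (allFin n))

headOr : ∀ {A : Set} → A → List A → A
headOr d [] = d
headOr d (x ∷ _) = x

-- lwpt_k(v): k-th element of L(v) closest to the root if |L(v)| ≥ k, else v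
lwpt : ∀ {n} → Graph n → (Fin n → Fin n) → ℕ → Fin n → Fin n
lwpt {n} E par k v =
  headOr v (filterᵇ (λ u → inL E par v u ∧ (rankL E par v u ≡ᵇ k)) (allFin n))

-- (-a, b) ≤lex (-a', b')
LexLe : ∀ {n} → (Fin n × Fin n) → (Fin n × Fin n) → Set
LexLe (a , b) (a' , b') = (toℕ a' < toℕ a) ⊎ ((toℕ a ≡ toℕ a') × (toℕ b ≤ toℕ b'))

-- the numbering (identity on Fin n) is compatible with T
Compatible : ∀ {n} → Graph n → Fin n → (Fin n → Fin n) → Set
Compatible {n} E r par =
  ((j w : Fin n) →
     (anc par j w ≡ true → (toℕ j ≤ toℕ w × toℕ w < toℕ j + ND par j)) ×
     ((toℕ j ≤ toℕ w × toℕ w < toℕ j + ND par j) → anc par j w ≡ true)) ×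
  ((j k : Fin n) → j ≢ r → k ≢ r → par j ≡ par k → toℕ j < toℕ k →
     LexLe (lwpt E par 1 j , lwpt E par 2 j) (lwpt E par 1 k , lwpt E par 2 k))

Child : ∀ {n} → Fin n → (Fin n → Fin n) → Fin n → Fin n → Set
Child r par v c = (c ≢ r) × (par c ≡ v)

-- c is the left child (largest child) of v
LeftChild : ∀ {n} → Fin n → (Fin n → Fin n) → Fin n → Fin n → Set
LeftChild {n} r par v c =
  Child r par v c × ((c' : Fin n) → Child r par v c' → toℕ c' ≤ toℕ c)

data Leftmost {n} (r : Fin n) (par : Fin n → Fin n) : Fin n → Fin n → Set where
  lm-here : ∀ {v} → Leftmost r par v v
  lm-step : ∀ {v c w} → LeftChild r par v c → Leftmost r par c w → Leftmost r par v w

{-# OPTIONS --safe #-}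
module Submission where

-- L(v) lies on the root path of v, which the compatible numbering orders increasingly, so lwpt(v)
-- is the least-numbered element of L(v).  For v ≠ root, lwpt(v) is adjacent to a descendant w₀
-- of v; if w₀ ≠ v then w₀ lies below a child c′ of v, and for the left child c the sibling order
-- gives lwpt(c) ≤ lwpt(c′) ≤ lwpt(v) < v.  So lwpt(c) is a proper ancestor of v adjacent to a
-- descendant of v, i.e. lwpt(c) ∈ L(v), whence lwpt(c) = lwpt(v) and induction continues along
-- left children.  At the root L is empty, lwpt(root) = root, and its left child is adjacent to it.

open import Defs

open import Data.Bool as Bool using (Bool; true; T; T?; not; _∧_)
open import Data.Bool.Properties using (T-≡; ∧-conicalˡ; ∧-conicalʳ)
open import Data.Bool.ListAction using (any)
open import Data.Fin as Fin using (Fin; toℕ; _≟_)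
open import Data.Fin.Properties using (toℕ-injective; pigeonhole; toℕ<n; any?)
open import Data.Fin.Induction using (>-wellFounded)
open import Data.List using (List; []; _∷_; length; filterᵇ; allFin; upTo)
open import Data.List.Membership.Propositional using (_∈_)
open import Data.List.Membership.Propositional.Properties using (∈-filter⁺; ∈-filter⁻; ∈-allFin; ∈-upTo⁺)
open import Data.List.Properties using (filter-none)
open import Data.List.Relation.Unary.All using (_∷_; tabulate)
open import Data.List.Relation.Unary.Any as Any using (here; there)
open import Data.List.Relation.Unary.Any.Properties using (any⁺; any⁻)
open import Data.List.Relation.Unary.AllPairs using (_∷_)
open import Data.List.Relation.Unary.Unique.Propositional using (Unique)
open import Data.List.Relation.Unary.Unique.Propositional.Properties using (filter⁺; allFin⁺)
open import Data.Nat using (ℕ; zero; suc; _+_; _∸_; _≤_; _<_; z≤n; s≤s; _≡ᵇ_)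
open import Data.Nat.Induction using (<-rec)
open import Data.Nat.Properties
  using ( _<?_; ≤-trans; ≤-<-trans; <-≤-trans; ≤-total; ≤-antisym; ≤-reflexive; ≤-pred; <⇒≤
        ; ≤∧≢⇒<; <⇒≢; <⇒≱; ≮⇒≥; m≤n⇒m<n∨m≡n; m≤n⇒m≤1+n; n≤1+n; n<1+n; m∸n+n≡m; +-monoʳ-<
        ; ≡⇒≡ᵇ; ≡ᵇ⇒≡ )
open import Data.Product using (∃; _×_; _,_; proj₁; proj₂)
open import Data.Sum using (_⊎_; inj₁; inj₂)
open import Function using (_∘_)
open import Function.Bundles using (module Equivalence)
open import Induction.WellFounded using (module All)
open import Relation.Binary.PropositionalEquality
open import Relation.Nullary using (Dec; yes; no; ¬_; contradiction)
open import Relation.Nullary.Decidable using (⌊_⌋; toWitness; fromWitness; fromWitnessFalse; ¬?; _×-dec_)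
open import Relation.Unary using (Pred; Decidable)

open Equivalence using (to; from)

private variable
  A : Set
  n : ℕ
  x y : A
  xs : List A

headOr-∈ : ∀ {d : A} → x ∈ xs → headOr d xs ∈ xs
headOr-∈ {xs = _ ∷ _} _ = here refl

headOr-filterᵇ : ∀ (p : A → Bool) {d} → x ∈ xs → p x ≡ true → p (headOr d (filterᵇ p xs)) ≡ true
headOr-filterᵇ {xs = xs} p x∈xs px =
  to T-≡ (proj₂ (∈-filter⁻ (T? ∘ p) {xs = xs} (headOr-∈ (∈-filter⁺ (T? ∘ p) x∈xs (from T-≡ px)))))

∈∈⇒2≤length : x ∈ xs → y ∈ xs → x ≢ y → 2 ≤ length xs
∈∈⇒2≤length (here refl) (here refl) x≢y = contradiction refl x≢y
∈∈⇒2≤length (here _) (there (here _)) _ = s≤s (s≤s z≤n)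
∈∈⇒2≤length (here _) (there (there _)) _ = s≤s (s≤s z≤n)
∈∈⇒2≤length (there (here _)) (here _) _ = s≤s (s≤s z≤n)
∈∈⇒2≤length (there (there _)) (here _) _ = s≤s (s≤s z≤n)
∈∈⇒2≤length (there x∈xs) (there y∈xs) x≢y = m≤n⇒m≤1+n (∈∈⇒2≤length x∈xs y∈xs x≢y)

Unique∧constant⇒length≡1 : Unique xs → x ∈ xs → (∀ {y} → y ∈ xs → y ≡ x) → length xs ≡ 1
Unique∧constant⇒length≡1 {xs = _ ∷ []} _ _ _ = refl
Unique∧constant⇒length≡1 {xs = _ ∷ _ ∷ _} ((y≢z ∷ _) ∷ _) _ const =
  contradiction (trans (const (here refl)) (sym (const (there (here refl))))) y≢z

any-true⁺ : ∀ (p : A → Bool) → x ∈ xs → p x ≡ true → any p xs ≡ true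
any-true⁺ p x∈xs px = to T-≡ (any⁺ p (Any.map (λ { refl → from T-≡ px }) x∈xs))

any-true⁻ : ∀ (p : A → Bool) xs → any p xs ≡ true → ∃ λ x → p x ≡ true
any-true⁻ p xs h with x , px ← Any.satisfied (any⁻ p xs (from T-≡ h)) = x , to T-≡ px

⌊⌋-true⁺ : {P : Set} (P? : Dec P) → P → ⌊ P? ⌋ ≡ true
⌊⌋-true⁺ P? p = to T-≡ (fromWitness p)

⌊⌋-true⁻ : {P : Set} (P? : Dec P) → ⌊ P? ⌋ ≡ true → P
⌊⌋-true⁻ P? h = toWitness (from T-≡ h)

not⌊⌋-true⁺ : {P : Set} (P? : Dec P) → ¬ P → not ⌊ P? ⌋ ≡ true
not⌊⌋-true⁺ P? ¬p = to T-≡ (fromWitnessFalse ¬p)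

-- LeftChild r par v is definitionally Greatest (Child r par v).
Least Greatest : ∀ {ℓ} → Pred (Fin n) ℓ → Pred (Fin n) ℓ
Least P m = P m × (∀ y → P y → toℕ m ≤ toℕ y)
Greatest P m = P m × (∀ y → P y → toℕ y ≤ toℕ m)

least : ∀ {ℓ} {P : Pred (Fin n) ℓ} → Decidable P → ∃ P → ∃ (Least P)
least {suc n} P? (a , pa) with P? Fin.zero
... | yes p₀ = Fin.zero , p₀ , λ _ _ → z≤n
least {suc n} P? (Fin.zero , pa) | no ¬p₀ = contradiction pa ¬p₀
least {suc n} P? (Fin.suc a , pa) | no ¬p₀
  with m , pm , m-least ← least (P? ∘ Fin.suc) (a , pa) =
  Fin.suc m , pm , λ { Fin.zero p₀ → contradiction p₀ ¬p₀ ; (Fin.suc y) py → s≤s (m-least y py) }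

greatest : ∀ {ℓ} {P : Pred (Fin n) ℓ} → Decidable P → ∃ P → ∃ (Greatest P)
greatest {suc n} {P = P} P? (a , pa) with any? (P? ∘ Fin.suc)
... | yes ∃p with m , pm , m-greatest ← greatest (P? ∘ Fin.suc) ∃p =
  Fin.suc m , pm , λ { Fin.zero _ → z≤n ; (Fin.suc y) py → s≤s (m-greatest y py) }
... | no ∄p = Fin.zero , p₀ a pa , λ { Fin.zero _ → z≤n ; (Fin.suc y) py → contradiction (y , py) ∄p }
  where
  p₀ : ∀ a → P a → P Fin.zero
  p₀ Fin.zero pa = pa
  p₀ (Fin.suc a) pa = contradiction (a , pa) ∄p

∃≢ : 2 ≤ n → (i : Fin n) → ∃ λ j → j ≢ i
∃≢ {suc zero} (s≤s ()) _
∃≢ {suc (suc _)} _ Fin.zero = Fin.suc Fin.zero , λ ()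
∃≢ {suc (suc _)} _ (Fin.suc _) = Fin.zero , λ ()

module _ {n} (f : Fin n → Fin n) where

  iter-+ : ∀ a b w → iter f (a + b) w ≡ iter f a (iter f b w)
  iter-+ zero b w = refl
  iter-+ (suc a) b w = cong f (iter-+ a b w)

  iter-∸ : ∀ {a b} w → a ≤ b → iter f (b ∸ a) (iter f a w) ≡ iter f b w
  iter-∸ {a} {b} w a≤b = trans (sym (iter-+ (b ∸ a) a w)) (cong (λ k → iter f k w) (m∸n+n≡m a≤b))

  iter-fixed : ∀ k {w} → f w ≡ w → iter f k w ≡ w
  iter-fixed zero _ = refl
  iter-fixed (suc k) fw≡w = trans (cong f (iter-fixed k fw≡w)) fw≡w

  iter-repeat : ∀ {a b} k w → a < b → b ≤ k → iter f a w ≡ iter f b w →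
                k ∸ b + a < k × iter f (k ∸ b + a) w ≡ iter f k w
  iter-repeat {a} {b} k w a<b b≤k fᵃw≡fᵇw =
    subst (k ∸ b + a <_) (m∸n+n≡m b≤k) (+-monoʳ-< (k ∸ b) a<b) ,
    (begin
      iter f (k ∸ b + a) w         ≡⟨ iter-+ (k ∸ b) a w ⟩
      iter f (k ∸ b) (iter f a w)  ≡⟨ cong (iter f (k ∸ b)) fᵃw≡fᵇw ⟩
      iter f (k ∸ b) (iter f b w)  ≡⟨ iter-∸ w b≤k ⟩
      iter f k w                   ∎)
    where open ≡-Reasoning

  -- By pigeonhole two of f⁰ w, …, fⁿ w coincide, and the loop between them can be cut out.
  iter-shortcut : ∀ w k → ∃ λ k′ → k′ < n × iter f k′ w ≡ iter f k w
  iter-shortcut w = <-rec _ shorten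
    where
    shorten : ∀ k → (∀ {j} → j < k → ∃ λ k′ → k′ < n × iter f k′ w ≡ iter f j w) →
              ∃ λ k′ → k′ < n × iter f k′ w ≡ iter f k w
    shorten k rec with k <? n
    ... | yes k<n = k , k<n , refl
    ... | no k≮n with i , j , i<j , fⁱw≡fʲw ← pigeonhole (n<1+n n) (λ i → iter f (toℕ i) w)
      with shorter , same ← iter-repeat k w i<j (≤-trans (≤-pred (toℕ<n j)) (≮⇒≥ k≮n)) fⁱw≡fʲw
      with k′ , k′<n , fᵏ′w≡ ← rec shorter = k′ , k′<n , trans fᵏ′w≡ same

module Ancestry {n} (par : Fin n → Fin n) where

  infix 4 _≤T_
  _≤T_ : Fin n → Fin n → Set
  u ≤T w = anc par u w ≡ true

  ≤T⁺ : ∀ k {u w} → iter par k w ≡ u → u ≤T w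
  ≤T⁺ k {u} {w} fᵏw≡u with k′ , k′<n , same ← iter-shortcut par w k =
    any-true⁺ (λ j → ⌊ iter par j w ≟ u ⌋) (∈-upTo⁺ k′<n) (⌊⌋-true⁺ (_ ≟ u) (trans same fᵏw≡u))

  ≤T⁻ : ∀ {u w} → u ≤T w → ∃ λ k → iter par k w ≡ u
  ≤T⁻ {u} {w} u≤w with k , e ← any-true⁻ (λ j → ⌊ iter par j w ≟ u ⌋) (upTo n) u≤w =
    k , ⌊⌋-true⁻ (iter par k w ≟ u) e

  ≤T-refl : ∀ {w} → w ≤T w
  ≤T-refl = ≤T⁺ 0 refl

  ≤T-parent : ∀ {w} → par w ≤T w
  ≤T-parent = ≤T⁺ 1 refl

  ≤T-trans : ∀ {u v w} → u ≤T v → v ≤T w → u ≤T w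
  ≤T-trans {w = w} u≤v v≤w with k , fᵏv≡u ← ≤T⁻ u≤v | m , fᵐw≡v ← ≤T⁻ v≤w =
    ≤T⁺ (k + m) (trans (iter-+ par k m w) (trans (cong (iter par k) fᵐw≡v) fᵏv≡u))

  later-iterate-≤T : ∀ {k m u v w} → k ≤ m → iter par k w ≡ u → iter par m w ≡ v → v ≤T u
  later-iterate-≤T {k} {m} {w = w} k≤m fᵏw≡u fᵐw≡v =
    ≤T⁺ (m ∸ k) (trans (cong (iter par (m ∸ k)) (sym fᵏw≡u)) (trans (iter-∸ par w k≤m) fᵐw≡v))

  ≤T-total : ∀ {u v w} → u ≤T w → v ≤T w → u ≤T v ⊎ v ≤T u
  ≤T-total u≤w v≤w with k , fᵏw≡u ← ≤T⁻ u≤w | m , fᵐw≡v ← ≤T⁻ v≤w | ≤-total k m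
  ... | inj₁ k≤m = inj₂ (later-iterate-≤T k≤m fᵏw≡u fᵐw≡v)
  ... | inj₂ m≤k = inj₁ (later-iterate-≤T m≤k fᵐw≡v fᵏw≡u)

  ≤T-fixed : ∀ {u w} → par w ≡ w → u ≤T w → u ≡ w
  ≤T-fixed par-w≡w u≤w with k , fᵏw≡u ← ≤T⁻ u≤w = trans (sym fᵏw≡u) (iter-fixed par k par-w≡w)

  child-on-path : ∀ k {v w} → iter par k w ≡ v → w ≢ v → ∃ λ c → c ≢ v × par c ≡ v × c ≤T w
  child-on-path zero w≡v w≢v = contradiction w≡v w≢v
  child-on-path (suc k) {v} {w} fᵏ⁺¹w≡v w≢v with iter par k w ≟ v
  ... | yes fᵏw≡v = child-on-path k fᵏw≡v w≢v
  ... | no c≢v = iter par k w , c≢v , fᵏ⁺¹w≡v , ≤T⁺ k refl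

module Tree {n} (E : Graph n) (r : Fin n) (par : Fin n → Fin n)
  (symmetric : ∀ u v → E u v ≡ E v u) (spanning : IsSpanningTree E r par) where

  open Ancestry par public

  par-root : par r ≡ r
  par-root = proj₁ spanning

  root-≤T : ∀ w → r ≤T w
  root-≤T w with k , fᵏw≡r ← proj₂ (proj₂ spanning) w = ≤T⁺ k fᵏw≡r

  par-≢ : ∀ {v} → v ≢ r → par v ≢ v
  par-≢ v≢r par-v≡v = v≢r (sym (≤T-fixed par-v≡v (root-≤T _)))

  tree-edge : ∀ {v} → v ≢ r → E (par v) v ≡ true
  tree-edge {v} v≢r = trans (symmetric (par v) v) (proj₁ (proj₂ spanning) v v≢r)

  child-≤T : ∀ {v c} → Child r par v c → v ≤T c
  child-≤T (_ , refl) = ≤T-parent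

  proper-descendant-child : ∀ {v w} → v ≤T w → w ≢ v → ∃ λ c → Child r par v c × c ≤T w
  proper-descendant-child {v} v≤w w≢v
    with k , fᵏw≡v ← ≤T⁻ v≤w
    with c , c≢v , par-c≡v , c≤w ← child-on-path k fᵏw≡v w≢v = c , (c≢r , par-c≡v) , c≤w
    where
    c≢r : c ≢ r
    c≢r refl = c≢v (trans (sym par-root) par-c≡v)

  root-has-child : 2 ≤ n → ∃ (Child r par r)
  root-has-child 2≤n
    with u , u≢r ← ∃≢ 2≤n r
    with c , c-child , _ ← proper-descendant-child (root-≤T u) u≢r = c , c-child

  Child? : ∀ v c → Dec (Child r par v c)
  Child? v c = ¬? (c ≟ r) ×-dec (par c ≟ v)

  infix 4 _∈L_
  _∈L_ : Fin n → Fin n → Set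
  u ∈L v = inL E par v u ≡ true

  ∈L⁺ : ∀ {u v w} → u ≤T v → u ≢ v → v ≤T w → E u w ≡ true → u ∈L v
  ∈L⁺ {u} {v} {w} u≤v u≢v v≤w uw∈E =
    cong₂ _∧_ u≤v (cong₂ _∧_ (not⌊⌋-true⁺ (u ≟ v) u≢v)
      (any-true⁺ (λ w → anc par v w ∧ E u w) (∈-allFin w) (cong₂ _∧_ v≤w uw∈E)))

  ∈L⁻ : ∀ {u v} → u ∈L v → u ≤T v × u ≢ v × ∃ λ w → v ≤T w × E u w ≡ true
  ∈L⁻ {u} {v} u∈Lv with anc par u v | u ≟ v
  ... | true | no u≢v with w , v≤w∧uw∈E ← any-true⁻ (λ w → anc par v w ∧ E u w) (allFin n) u∈Lv =
    refl , u≢v , w , ∧-conicalˡ (anc par v w) _ v≤w∧uw∈E , ∧-conicalʳ (anc par v w) _ v≤w∧uw∈E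

  parent-∈L : ∀ {v} → v ≢ r → par v ∈L v
  parent-∈L v≢r = ∈L⁺ ≤T-parent (par-≢ v≢r) ≤T-refl (tree-edge v≢r)

  lwpt₁ : Fin n → Fin n
  lwpt₁ = lwpt E par 1

  isLwpt₁ : Fin n → Fin n → Bool
  isLwpt₁ v u = inL E par v u ∧ (rankL E par v u ≡ᵇ 1)

  lwpt₁-root : lwpt₁ r ≡ r
  lwpt₁-root =
    cong (headOr r) (filter-none (T? ∘ isLwpt₁ r) {xs = allFin n} (tabulate λ {u} _ → not-in-L[r] u))
    where
    not-in-L[r] : ∀ u → ¬ T (isLwpt₁ r u)
    not-in-L[r] u h with u≤r , u≢r , _ ← ∈L⁻ (∧-conicalˡ (inL E par r u) _ (to T-≡ h)) =
      u≢r (≤T-fixed par-root u≤r)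

module Numbering {n} (E : Graph n) (r : Fin n) (par : Fin n → Fin n)
  (symmetric : ∀ u v → E u v ≡ E v u) (spanning : IsSpanningTree E r par)
  (compatible : Compatible E r par) where

  open Tree E r par symmetric spanning public

  ≤T⇒≤ : ∀ {u w} → u ≤T w → toℕ u ≤ toℕ w
  ≤T⇒≤ {u} {w} = proj₁ ∘ proj₁ (proj₁ compatible u w)

  ≤T∧≢⇒< : ∀ {u w} → u ≤T w → u ≢ w → toℕ u < toℕ w
  ≤T∧≢⇒< u≤w u≢w = ≤∧≢⇒< (≤T⇒≤ u≤w) (u≢w ∘ toℕ-injective)

  child⇒< : ∀ {v c} → Child r par v c → toℕ v < toℕ c
  child⇒< c-child@(c≢r , refl) = ≤T∧≢⇒< (child-≤T c-child) (par-≢ c≢r)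

  ∈L⇒< : ∀ {u v} → u ∈L v → toℕ u < toℕ v
  ∈L⇒< u∈Lv with u≤v , u≢v , _ ← ∈L⁻ u∈Lv = ≤T∧≢⇒< u≤v u≢v

  ∈L-lower : ∀ {u v c w} → v ≤T c → c ≤T w → E u w ≡ true → u ∈L v → u ∈L c
  ∈L-lower v≤c c≤w uw∈E u∈Lv with u≤v , _ ← ∈L⁻ u∈Lv =
    ∈L⁺ (≤T-trans u≤v v≤c) (<⇒≢ (<-≤-trans (∈L⇒< u∈Lv) (≤T⇒≤ v≤c)) ∘ cong toℕ) c≤w uw∈E

  ∈L-raise : ∀ {u v c} → u ∈L c → v ≤T c → toℕ u < toℕ v → u ∈L v
  ∈L-raise u∈Lc v≤c u<v with u≤c , _ , w , c≤w , uw∈E ← ∈L⁻ u∈Lc with ≤T-total u≤c v≤c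
  ... | inj₁ u≤v = ∈L⁺ u≤v (<⇒≢ u<v ∘ cong toℕ) (≤T-trans v≤c c≤w) uw∈E
  ... | inj₂ v≤u = contradiction (≤T⇒≤ v≤u) (<⇒≱ u<v)

  module _ (v : Fin n) where

    inL-above : Fin n → Fin n → Bool
    inL-above u u′ = inL E par v u′ ∧ anc par u′ u

    rankL-least : ∀ {m} → Least (_∈L v) m → rankL E par v m ≡ 1
    rankL-least {m} (m∈Lv , m-least) =
      Unique∧constant⇒length≡1 (filter⁺ (T? ∘ inL-above m) (allFin⁺ n))
        (∈-filter⁺ (T? ∘ inL-above m) (∈-allFin m) (from T-≡ (cong₂ _∧_ m∈Lv ≤T-refl))) only-m
      where
      only-m : ∀ {y} → y ∈ filterᵇ (inL-above m) (allFin n) → y ≡ m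
      only-m {y} y∈ with _ , y-above ← ∈-filter⁻ (T? ∘ inL-above m) {xs = allFin n} y∈ =
        let y∈Lv∧y≤m = to T-≡ y-above in
        toℕ-injective (≤-antisym (≤T⇒≤ (∧-conicalʳ (inL E par v y) _ y∈Lv∧y≤m))
                                 (m-least y (∧-conicalˡ (inL E par v y) _ y∈Lv∧y≤m)))

    rankL-≥2 : ∀ {m h} → m ∈L v → h ∈L v → m ≤T h → m ≢ h → 2 ≤ rankL E par v h
    rankL-≥2 {m} {h} m∈Lv h∈Lv m≤h m≢h =
      ∈∈⇒2≤length (∈-filter⁺ (T? ∘ inL-above h) (∈-allFin m) (from T-≡ (cong₂ _∧_ m∈Lv m≤h)))
                  (∈-filter⁺ (T? ∘ inL-above h) (∈-allFin h) (from T-≡ (cong₂ _∧_ h∈Lv ≤T-refl))) m≢h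

    lwpt₁-rank₁ : ∀ {m} → Least (_∈L v) m → lwpt₁ v ∈L v × rankL E par v (lwpt₁ v) ≡ 1
    lwpt₁-rank₁ {m} m-least@(m∈Lv , _) =
      ∧-conicalˡ (inL E par v (lwpt₁ v)) _ isLwpt₁-lwpt₁ ,
      ≡ᵇ⇒≡ _ 1 (from T-≡ (∧-conicalʳ (inL E par v (lwpt₁ v)) _ isLwpt₁-lwpt₁))
      where
      isLwpt₁-lwpt₁ : isLwpt₁ v (lwpt₁ v) ≡ true
      isLwpt₁-lwpt₁ = headOr-filterᵇ (isLwpt₁ v) (∈-allFin m)
                        (cong₂ _∧_ m∈Lv (to T-≡ (≡⇒≡ᵇ _ 1 (rankL-least m-least))))

    lwpt₁≡least : ∀ {m} → Least (_∈L v) m → lwpt₁ v ≡ m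
    lwpt₁≡least {m} m-least@(m∈Lv , m-min)
      with h∈Lv , h-rank ← lwpt₁-rank₁ m-least
      with ≤T-total (proj₁ (∈L⁻ h∈Lv)) (proj₁ (∈L⁻ m∈Lv))
    ... | inj₁ h≤m = toℕ-injective (≤-antisym (≤T⇒≤ h≤m) (m-min _ h∈Lv))
    ... | inj₂ m≤h with lwpt₁ v ≟ m
    ...   | yes h≡m = h≡m
    ...   | no h≢m = contradiction (subst (2 ≤_) h-rank (rankL-≥2 m∈Lv h∈Lv m≤h (h≢m ∘ sym))) λ { (s≤s ()) }

    lwpt₁-least : ∀ {u} → u ∈L v → Least (_∈L v) (lwpt₁ v)
    lwpt₁-least {u} u∈Lv with m , m-least ← least (λ y → inL E par v y Bool.≟ true) (u , u∈Lv) =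
      subst (Least (_∈L v)) (sym (lwpt₁≡least m-least)) m-least

  lwpt₁-leftChild-≤ : ∀ {v c c′} → LeftChild r par v c → Child r par v c′ →
                      toℕ (lwpt₁ c) ≤ toℕ (lwpt₁ c′)
  lwpt₁-leftChild-≤ ((c≢r , par-c≡v) , c-max) c′-child@(c′≢r , par-c′≡v)
    with m≤n⇒m<n∨m≡n (c-max _ c′-child)
  ... | inj₂ c′≡c = ≤-reflexive (cong (toℕ ∘ lwpt₁) (sym (toℕ-injective c′≡c)))
  ... | inj₁ c′<c with proj₂ compatible _ _ c′≢r c≢r (trans par-c′≡v (sym par-c≡v)) c′<c
  ...   | inj₁ lwpt₁c<lwpt₁c′ = <⇒≤ lwpt₁c<lwpt₁c′
  ...   | inj₂ (lwpt₁c′≡lwpt₁c , _) = ≤-reflexive (sym lwpt₁c′≡lwpt₁c)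

  lwpt₁-leftChild : ∀ {v c c′ w} → v ≢ r → LeftChild r par v c → Child r par v c′ → c′ ≤T w →
                    E (lwpt₁ v) w ≡ true → lwpt₁ c ≡ lwpt₁ v
  lwpt₁-leftChild {v} {c} {c′} v≢r c-left@((c≢r , _) , _) c′-child c′≤w xw∈E =
    toℕ-injective (≤-antisym x′≤x (x-min _ x′∈Lv))
    where
    x∈Lv : lwpt₁ v ∈L v
    x∈Lv = proj₁ (lwpt₁-least v (parent-∈L v≢r))
    x-min : ∀ y → y ∈L v → toℕ (lwpt₁ v) ≤ toℕ y
    x-min = proj₂ (lwpt₁-least v (parent-∈L v≢r))
    x∈Lc′ : lwpt₁ v ∈L c′
    x∈Lc′ = ∈L-lower (child-≤T c′-child) c′≤w xw∈E x∈Lv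
    x′≤x : toℕ (lwpt₁ c) ≤ toℕ (lwpt₁ v)
    x′≤x = ≤-trans (lwpt₁-leftChild-≤ c-left c′-child) (proj₂ (lwpt₁-least c′ x∈Lc′) _ x∈Lc′)
    x′∈Lv : lwpt₁ c ∈L v
    x′∈Lv = ∈L-raise (proj₁ (lwpt₁-least c (parent-∈L c≢r))) (child-≤T (proj₁ c-left))
                     (≤-<-trans x′≤x (∈L⇒< x∈Lv))

  LeftmostAdjLwpt : Fin n → Set
  LeftmostAdjLwpt v = ∃ λ w → Leftmost r par v w × E (lwpt₁ v) w ≡ true

  leftmost-via : ∀ {v w₀} → v ≢ r → (∀ {c} → Child r par v c → LeftmostAdjLwpt c) →
                 v ≤T w₀ → E (lwpt₁ v) w₀ ≡ true → LeftmostAdjLwpt v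
  leftmost-via {v} {w₀} v≢r ih v≤w₀ xw₀∈E with w₀ ≟ v
  ... | yes refl = w₀ , lm-here , xw₀∈E
  ... | no w₀≢v =
    let c′ , c′-child , c′≤w₀ = proper-descendant-child v≤w₀ w₀≢v
        c , c-left = greatest (Child? v) (c′ , c′-child)
        w , c⇝w , xc-w∈E = ih (proj₁ c-left)
    in w , lm-step c-left c⇝w ,
       subst (λ x → E x w ≡ true) (lwpt₁-leftChild v≢r c-left c′-child c′≤w₀ xw₀∈E) xc-w∈E

  leftmost-step : ∀ {v} → v ≢ r → (∀ {c} → Child r par v c → LeftmostAdjLwpt c) → LeftmostAdjLwpt v
  leftmost-step {v} v≢r ih =
    let _ , _ , w₀ , v≤w₀ , xw₀∈E = ∈L⁻ (proj₁ (lwpt₁-least v (parent-∈L v≢r)))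
    in leftmost-via v≢r ih v≤w₀ xw₀∈E

  leftmost-root : 2 ≤ n → LeftmostAdjLwpt r
  leftmost-root 2≤n with c , c-left@((c≢r , par-c≡r) , _) ← greatest (Child? r) (root-has-child 2≤n) =
    c , lm-step c-left lm-here ,
    subst (λ x → E x c ≡ true) (trans par-c≡r (sym lwpt₁-root)) (tree-edge c≢r)

lemma3p1 : (n : ℕ) (E : Graph n) (r : Fin n) (par : Fin n → Fin n) →
    IsSimple E → TwoConnected E → IsSpanningTree E r par → IsNormal E par →
    Compatible E r par →
    (v : Fin n) → ∃ λ w → Leftmost r par v w × (E (lwpt E par 1 v) w ≡ true)
lemma3p1 n E r par (symmetric , _) (3≤n , _) spanning _ compatible =
  All.wfRec >-wellFounded _ LeftmostAdjLwpt leftmost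
  where
  open Numbering E r par symmetric spanning compatible
  leftmost : ∀ v → (∀ {c} → toℕ v < toℕ c → LeftmostAdjLwpt c) → LeftmostAdjLwpt v
  leftmost v ih with v ≟ r
  ... | yes refl = leftmost-root (≤-trans (n≤1+n 2) 3≤n)
  ... | no v≢r = leftmost-step v≢r (ih ∘ child⇒<)
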